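{- For all positive integers $s$ and $t$, the minimum of $\mathrm{inv}(\pi)$ over all linear extensions $\pi$ of $EN_{s,t}$ that avoid $1243$ is $(t^2-t+1)\binom{s}{2}$, and the maximum is $t^2\binom{s}{2}$.
   Context: Write each $x \in [st]$ uniquely as $x=(j-1)t+r$ with $1\le j\le s$, $1\le r\le t$. The poset $EN_{s,t}$ is $[st]$ with $(j-1)t+r \preceq (j'-1)t+r'$ iff $j'\le j$ and $r\le r'$. A linear extension of a poset $([n],\preceq)$ is a permutation $\pi$ of $[n]$ in one-line notation such that whenever $a\preceq b$, $a\ne b$, $a$ appears before $b$. $\pi$ avoids $1243$ if it has no subsequence with the same relative order as $1243$. $\mathrm{inv}(\pi)$ is the number of pairs of positions $i<j$ with $\pi(i)>\pi(j)$. -}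

module Defs where

open import Data.Nat using (ℕ; zero; suc; _+_; _*_; _∸_; _≤_; _<_; _<?_)
open import Data.List using (List; []; _∷_; _++_; map; upTo; length; filter)
open import Data.List.Membership.Propositional using (_∈_)
open import Data.List.Relation.Binary.Permutation.Propositional using (_↭_)
open import Data.List.Relation.Binary.Sublist.Propositional using (_⊆_)
open import Data.Product using (Σ; ∃; _×_; _,_)
open import Relation.Nullary using (¬_)
open import Relation.Binary.PropositionalEquality using (_≡_; _≢_)

[_] : ℕ → List ℕ
[ n ] = map suc (upTo n)

IsPerm : ℕ → List ℕ → Set
IsPerm n π = π ↭ [ n ]

ENle : ℕ → ℕ → ℕ → ℕ → Set
ENle s t x y =
  Σ ℕ λ j → Σ ℕ λ r → Σ ℕ λ j' → Σ ℕ λ r' →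
    (1 ≤ j) × (j ≤ s) × (1 ≤ r) × (r ≤ t) ×
    (1 ≤ j') × (j' ≤ s) × (1 ≤ r') × (r' ≤ t) ×
    (x ≡ (j ∸ 1) * t + r) × (y ≡ (j' ∸ 1) * t + r') ×
    (j' ≤ j) × (r ≤ r')

Before : ℕ → ℕ → List ℕ → Set
Before a b π = Σ (List ℕ) λ xs → Σ (List ℕ) λ ys → (π ≡ xs ++ (a ∷ ys)) × (b ∈ ys)

IsLinExtEN : ℕ → ℕ → List ℕ → Set
IsLinExtEN s t π =
  IsPerm (s * t) π ×
  (∀ a b → ENle s t a b → a ≢ b → Before a b π)

Contains1243 : List ℕ → Set
Contains1243 π = Σ ℕ λ a → Σ ℕ λ b → Σ ℕ λ c → Σ ℕ λ d →
  ((a ∷ b ∷ c ∷ d ∷ []) ⊆ π) × (a < b) × (b < d) × (d < c)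

Avoids1243 : List ℕ → Set
Avoids1243 π = ¬ Contains1243 π

inv : List ℕ → ℕ
inv [] = 0
inv (x ∷ xs) = length (filter (_<? x) xs) + inv xs

module Submission where

-- Let K = (s − 1)t. The entries above K form the top block of EN_{s,t}, whose least element
-- K + 1 lies below everything. In a linear extension π the top block appears in increasing
-- order and the entries ≤ K form a linear extension of EN_{s−1,t}, so inv π is inv of that
-- restriction plus the number of pairs "top-block entry before smaller entry", which is at
-- most tK; this gives the upper bound t²·C(s,2). If π also avoids 1243, it starts with K + 1,
-- which precedes all K small entries, and a small entry y preceding another top-block entry b
-- must be the least element of its block: if y is the largest then b ≺ y, and otherwise the
-- least and largest elements of y's block together with y and b form a 1243. Hence each of
-- the t − 1 other top-block entries precedes at least K − (s − 1) small entries, and the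
-- increments (s − 1)(t² − t + 1) sum to (t² − t + 1)·C(s,2). Both bounds are attained: list
-- the blocks from the top down, resp. first all block minima in decreasing order and then
-- the rest of the blocks from the top down.

open import Defs
open import Data.Nat using (ℕ; zero; suc; _+_; _*_; _∸_; _^_; _≤_; _<_; _<?_; _≤?_; z≤n; s≤s)
open import Algebra.Properties.CommutativeSemigroup using (interchange)
open import Data.Bool using (true; false)
open import Data.Empty using (⊥; ⊥-elim)
open import Data.List using (List; []; _∷_; _++_; length; filter; applyUpTo; applyDownFrom)
open import Data.List.Properties using (length-++; filter-++; filter-all; filter-none; filter-accept; filter-reject; map-upTo; length-applyUpTo; ++-identityʳ)
open import Data.List.Membership.Propositional using (_∈_)
open import Data.List.Membership.Propositional.Properties using (∈-++⁺ˡ; ∈-++⁺ʳ; ∈-++⁻; ∈-∃++; ∈-applyUpTo⁺; ∈-applyUpTo⁻; ∈-applyDownFrom⁺; ∈-applyDownFrom⁻; ∈-filter⁻)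
open import Data.List.Relation.Unary.All as All using (All; []; _∷_)
open import Data.List.Relation.Unary.All.Properties using (all-filter)
open import Data.List.Relation.Unary.AllPairs as AllPairs using (AllPairs; []; _∷_)
open import Data.List.Relation.Unary.AllPairs.Properties using (applyUpTo⁺₁; applyDownFrom⁺₁)
open import Data.List.Relation.Unary.Any using (here; there)
open import Data.List.Relation.Unary.Unique.Propositional using (Unique)
open import Data.List.Relation.Unary.Unique.Propositional.Properties using (Unique[x∷xs]⇒x∉xs)
open import Data.List.Relation.Binary.Permutation.Propositional using (module PermutationReasoning; _↭_; ↭-sym; ↭-trans; ↭-refl; ↭-prep; ↭-reflexive; ↭⇒↭ₛ)
open import Data.List.Relation.Binary.Permutation.Propositional.Properties using (∈-resp-↭; ↭-length; ↭-empty-inv; filter-↭; shifts; ++-comm)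
  renaming (++⁺ˡ to ↭-++⁺ˡ; ++⁺ʳ to ↭-++⁺ʳ)
open import Data.List.Relation.Binary.Permutation.Setoid.Properties using (Unique-resp-↭)
open import Data.List.Relation.Binary.Sublist.Propositional {A = ℕ} using (_⊆_; []; _∷_; _∷ʳ_; from∈; to∈; ⊆-refl; ⊆-trans; minimum)
  renaming (lookup to ⊆-lookup)
open import Data.List.Relation.Binary.Sublist.Propositional.Properties using (∷ˡ⁻; filter-⊆; filter⁺; All-resp-⊆)
  renaming (++⁺ to ⊆-++⁺; ++⁺ˡ to ⊆-++⁺ˡ; ++⁺ʳ to ⊆-++⁺ʳ)
open import Data.Nat.Combinatorics using (_C_; nC1≡n; nCk+nC[k+1]≡[n+1]C[k+1])
open import Data.Nat.Properties
open import Data.Nat.Tactic.RingSolver using (solve-∀)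
open import Data.Product using (Σ; ∃; ∃₂; _×_; _,_; proj₁; proj₂)
open import Data.Sum using (_⊎_; inj₁; inj₂)
open import Function using (_∘_)
open import Relation.Binary.Definitions using (Asymmetric; tri<; tri≈; tri>)
open import Relation.Binary.PropositionalEquality using (_≡_; _≢_; ≢-sym; refl; sym; trans; cong; cong₂; subst; subst₂; setoid; module ≡-Reasoning)
open import Relation.Nullary using (¬_; yes; no; does)
open import Relation.Unary using (Pred; Decidable)
open import Relation.Unary.Properties using (∁?)

Before⇒⊆ : ∀ {a b π} → Before a b π → (a ∷ b ∷ []) ⊆ π
Before⇒⊆ (xs , _ , refl , b∈) = ⊆-++⁺ˡ xs (refl ∷ from∈ b∈)

⊆⇒Before : ∀ {a b π} → (a ∷ b ∷ []) ⊆ π → Before a b π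
⊆⇒Before (y ∷ʳ p) with xs , ys , refl , b∈ ← ⊆⇒Before p = y ∷ xs , ys , refl , b∈
⊆⇒Before (refl ∷ p) = [] , _ , refl , to∈ p

nothing-before-head : ∀ {a h xs} → Unique (h ∷ xs) → ¬ (a ∷ h ∷ []) ⊆ (h ∷ xs)
nothing-before-head u (_ ∷ʳ p) = Unique[x∷xs]⇒x∉xs u (to∈ (∷ˡ⁻ p))
nothing-before-head u (refl ∷ p) = Unique[x∷xs]⇒x∉xs u (to∈ p)

⊆-asym : ∀ {a b π} → Unique π → (a ∷ b ∷ []) ⊆ π → ¬ (b ∷ a ∷ []) ⊆ π
⊆-asym (_ ∷ u) (y ∷ʳ p) (.y ∷ʳ q) = ⊆-asym u p q
⊆-asym u (_ ∷ʳ p) (refl ∷ q) = nothing-before-head u (_ ∷ʳ p)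
⊆-asym u (refl ∷ p) q = nothing-before-head u q

⊆-chain : ∀ {a b cs π} → Unique π → (a ∷ b ∷ []) ⊆ π → (b ∷ cs) ⊆ π → (a ∷ b ∷ cs) ⊆ π
⊆-chain (_ ∷ u) (y ∷ʳ p) (.y ∷ʳ q) = y ∷ʳ ⊆-chain u p q
⊆-chain u (_ ∷ʳ p) (refl ∷ q) = ⊥-elim (nothing-before-head u (_ ∷ʳ p))
⊆-chain u (refl ∷ p) (_ ∷ʳ q) = refl ∷ q
⊆-chain u (refl ∷ p) (refl ∷ q) = ⊥-elim (Unique[x∷xs]⇒x∉xs u (to∈ p))

⊆-++⁻ : ∀ {xs} A B → xs ⊆ A ++ B → Σ (List ℕ) λ ys → Σ (List ℕ) λ zs → xs ≡ ys ++ zs × ys ⊆ A × zs ⊆ B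
⊆-++⁻ [] B p = [] , _ , refl , [] , p
⊆-++⁻ (a ∷ A) B (.a ∷ʳ p) with ys , zs , eq , p₁ , p₂ ← ⊆-++⁻ A B p = ys , zs , eq , a ∷ʳ p₁ , p₂
⊆-++⁻ (a ∷ A) B (refl ∷ p) with ys , zs , refl , p₁ , p₂ ← ⊆-++⁻ A B p = a ∷ ys , zs , refl , refl ∷ p₁ , p₂

⊆-filter : ∀ {p} {P : Pred ℕ p} (P? : Decidable P) {xs ys} → xs ⊆ ys → All P xs → xs ⊆ filter P? ys
⊆-filter P? p all = subst (_⊆ _) (filter-all P? all) (filter⁺ P? P? (λ { refl q → q }) p)

module _ {R : ℕ → ℕ → Set} where

  AllPairs-pair : ∀ {x y zs π} → AllPairs R π → (x ∷ y ∷ zs) ⊆ π → R x y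
  AllPairs-pair (_ ∷ rs) (_ ∷ʳ p) = AllPairs-pair rs p
  AllPairs-pair (r ∷ _) (refl ∷ p) = All.lookup r (to∈ p)

  AllPairs-⊆ : ∀ {xs ys} → AllPairs R ys → xs ⊆ ys → AllPairs R xs
  AllPairs-⊆ [] [] = []
  AllPairs-⊆ (_ ∷ rs) (_ ∷ʳ p) = AllPairs-⊆ rs p
  AllPairs-⊆ (r ∷ rs) (refl ∷ p) = All.tabulate (λ z∈ → All.lookup r (⊆-lookup p z∈)) ∷ AllPairs-⊆ rs p

  pairs⇒AllPairs : ∀ π → (∀ {x y} → (x ∷ y ∷ []) ⊆ π → R x y) → AllPairs R π
  pairs⇒AllPairs [] _ = []
  pairs⇒AllPairs (x ∷ π) r = All.tabulate (λ y∈ → r (refl ∷ from∈ y∈)) ∷ pairs⇒AllPairs π (λ p → r (x ∷ʳ p))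

  AllPairs⇒pair⊆ : Asymmetric R → ∀ {x y π} → AllPairs R π → x ∈ π → y ∈ π → R x y → (x ∷ y ∷ []) ⊆ π
  AllPairs⇒pair⊆ asym (_ ∷ _) (here refl) (here refl) r = ⊥-elim (asym r r)
  AllPairs⇒pair⊆ asym (_ ∷ _) (here refl) (there y∈) r = refl ∷ from∈ y∈
  AllPairs⇒pair⊆ asym (s ∷ _) (there x∈) (here refl) r = ⊥-elim (asym r (All.lookup s x∈))
  AllPairs⇒pair⊆ asym (_ ∷ rs) (there x∈) (there y∈) r = _ ∷ʳ AllPairs⇒pair⊆ asym rs x∈ y∈ r

Unique⇒length≤ : ∀ (xs ys : List ℕ) → Unique xs → (∀ {x} → x ∈ xs → x ∈ ys) → length xs ≤ length ys
Unique⇒length≤ [] ys _ _ = z≤n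
Unique⇒length≤ (x ∷ xs) ys (x∉ ∷ u) sub with ys₁ , ys₂ , refl ← ∈-∃++ (sub (here refl)) = begin
  suc (length xs)              ≤⟨ s≤s (Unique⇒length≤ xs (ys₁ ++ ys₂) u sub′) ⟩
  suc (length (ys₁ ++ ys₂))     ≡⟨ cong suc (length-++ ys₁) ⟩
  suc (length ys₁ + length ys₂) ≡⟨ sym (+-suc _ _) ⟩
  length ys₁ + length (x ∷ ys₂) ≡⟨ sym (length-++ ys₁) ⟩
  length (ys₁ ++ x ∷ ys₂)       ∎
  where
  open ≤-Reasoning
  sub′ : ∀ {y} → y ∈ xs → y ∈ ys₁ ++ ys₂
  sub′ {y} y∈ with ∈-++⁻ ys₁ (sub (there y∈))
  ... | inj₁ p = ∈-++⁺ˡ p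
  ... | inj₂ (here refl) = ⊥-elim (All.lookup x∉ y∈ refl)
  ... | inj₂ (there p) = ∈-++⁺ʳ ys₁ p

length-filter-split : ∀ {p q} {P : Pred ℕ p} {Q : Pred ℕ q} (P? : Decidable P) (Q? : Decidable Q) xs →
  length (filter P? xs) ≡ length (filter P? (filter Q? xs)) + length (filter P? (filter (∁? Q?) xs))
length-filter-split P? Q? [] = refl
length-filter-split P? Q? (x ∷ xs) with Q? x
... | yes _ with P? x
...   | yes _ = cong suc (length-filter-split P? Q? xs)
...   | no _ = length-filter-split P? Q? xs
length-filter-split P? Q? (x ∷ xs) | no _ with P? x
...   | yes _ = trans (cong suc (length-filter-split P? Q? xs)) (sym (+-suc _ _))
...   | no _ = length-filter-split P? Q? xs

lesser : ℕ → List ℕ → ℕ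
lesser x xs = length (filter (_<? x) xs)

invAcross : List ℕ → List ℕ → ℕ
invAcross [] _ = 0
invAcross (x ∷ xs) ys = lesser x ys + invAcross xs ys

lesser-++ : ∀ x xs ys → lesser x (xs ++ ys) ≡ lesser x xs + lesser x ys
lesser-++ x xs ys = trans (cong length (filter-++ (_<? x) xs ys)) (length-++ (filter (_<? x) xs))

lesser-none : ∀ {x} ys → All (x ≤_) ys → lesser x ys ≡ 0
lesser-none ys x≤ = cong length (filter-none (_<? _) (All.map ≤⇒≯ x≤))

lesser-all : ∀ {x} ys → All (_< x) ys → lesser x ys ≡ length ys
lesser-all ys <x = cong length (filter-all (_<? _) <x)

inv-++ : ∀ xs ys → inv (xs ++ ys) ≡ inv xs + inv ys + invAcross xs ys
inv-++ [] ys = sym (+-identityʳ (inv ys))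
inv-++ (x ∷ xs) ys = begin
  lesser x (xs ++ ys) + inv (xs ++ ys)
    ≡⟨ cong₂ _+_ (lesser-++ x xs ys) (inv-++ xs ys) ⟩
  (lesser x xs + lesser x ys) + (inv xs + inv ys + invAcross xs ys)
    ≡⟨ regroup (lesser x xs) (lesser x ys) (inv xs) (inv ys) (invAcross xs ys) ⟩
  (lesser x xs + inv xs) + inv ys + (lesser x ys + invAcross xs ys) ∎
  where
  open ≡-Reasoning
  regroup : ∀ a b c d e → (a + b) + (c + d + e) ≡ (a + c) + d + (b + e)
  regroup = solve-∀

invAcross-++ : ∀ xs ys zs → invAcross xs (ys ++ zs) ≡ invAcross xs ys + invAcross xs zs
invAcross-++ [] ys zs = refl
invAcross-++ (x ∷ xs) ys zs = begin
  lesser x (ys ++ zs) + invAcross xs (ys ++ zs)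
    ≡⟨ cong₂ _+_ (lesser-++ x ys zs) (invAcross-++ xs ys zs) ⟩
  (lesser x ys + lesser x zs) + (invAcross xs ys + invAcross xs zs)
    ≡⟨ interchange +-commutativeSemigroup (lesser x ys) (lesser x zs) (invAcross xs ys) (invAcross xs zs) ⟩
  (lesser x ys + invAcross xs ys) + (lesser x zs + invAcross xs zs) ∎
  where open ≡-Reasoning

invAcross-none : ∀ xs ys → (∀ {x y} → x ∈ xs → y ∈ ys → x < y) → invAcross xs ys ≡ 0
invAcross-none [] ys _ = refl
invAcross-none (x ∷ xs) ys x<y =
  cong₂ _+_ (lesser-none ys (All.tabulate (λ y∈ → <⇒≤ (x<y (here refl) y∈))))
            (invAcross-none xs ys (λ x∈ → x<y (there x∈)))

invAcross-all : ∀ xs ys → (∀ {x y} → x ∈ xs → y ∈ ys → y < x) → invAcross xs ys ≡ length xs * length ys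
invAcross-all [] ys _ = refl
invAcross-all (x ∷ xs) ys y<x =
  cong₂ _+_ (lesser-all ys (All.tabulate (y<x (here refl)))) (invAcross-all xs ys (λ x∈ → y<x (there x∈)))

inv-increasing : ∀ {xs} → AllPairs _<_ xs → inv xs ≡ 0
inv-increasing [] = refl
inv-increasing {x ∷ xs} (x< ∷ rs) = cong₂ _+_ (lesser-none xs (All.map <⇒≤ x<)) (inv-increasing rs)

C2-suc : ∀ m → suc m C 2 ≡ m + m C 2
C2-suc m = trans (sym (nCk+nC[k+1]≡[n+1]C[k+1] m 1)) (cong (_+ m C 2) (nC1≡n m))

inv-decreasing : ∀ {xs} → AllPairs (λ x y → y < x) xs → inv xs ≡ length xs C 2
inv-decreasing [] = refl
inv-decreasing {x ∷ xs} (<x ∷ rs) =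
  trans (cong₂ _+_ (lesser-all xs <x) (inv-decreasing rs)) (sym (C2-suc (length xs)))

module Threshold {p} {P : Pred ℕ p} (P? : Decidable P) where

  Lo Hi : List ℕ → List ℕ
  Lo = filter P?
  Hi = filter (∁? P?)

  cross : List ℕ → ℕ
  cross [] = 0
  cross (x ∷ xs) with does (P? x)
  ... | true = cross xs
  ... | false = length (Lo xs) + cross xs

  cross-∷-high : ∀ {x} xs → ¬ P x → cross (x ∷ xs) ≡ length (Lo xs) + cross xs
  cross-∷-high {x} xs ¬px with P? x
  ... | yes px = ⊥-elim (¬px px)
  ... | no _ = refl

  lesser-split : ∀ x xs → lesser x xs ≡ lesser x (Lo xs) + lesser x (Hi xs)
  lesser-split x = length-filter-split (_<? x) P?

  module _ (low<high : ∀ {x y} → P x → ¬ P y → x < y) where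

    inv-split : ∀ xs → inv xs ≡ inv (Lo xs) + inv (Hi xs) + cross xs
    inv-split [] = refl
    inv-split (x ∷ xs) with P? x
    ... | yes px = begin
      lesser x xs + inv xs
        ≡⟨ cong₂ _+_ (lesser-split x xs) (inv-split xs) ⟩
      (lesser x (Lo xs) + lesser x (Hi xs)) + (inv (Lo xs) + inv (Hi xs) + cross xs)
        ≡⟨ cong (λ n → (lesser x (Lo xs) + n) + _)
                (lesser-none (Hi xs) (All.map (λ ¬py → <⇒≤ (low<high px ¬py)) (all-filter (∁? P?) xs))) ⟩
      (lesser x (Lo xs) + 0) + (inv (Lo xs) + inv (Hi xs) + cross xs)
        ≡⟨ regroup (lesser x (Lo xs)) (inv (Lo xs)) (inv (Hi xs)) (cross xs) ⟩
      (lesser x (Lo xs) + inv (Lo xs)) + inv (Hi xs) + cross xs ∎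
      where
      open ≡-Reasoning
      regroup : ∀ a b c d → (a + 0) + (b + c + d) ≡ (a + b) + c + d
      regroup = solve-∀
    ... | no ¬px = begin
      lesser x xs + inv xs
        ≡⟨ cong₂ _+_ (lesser-split x xs) (inv-split xs) ⟩
      (lesser x (Lo xs) + lesser x (Hi xs)) + (inv (Lo xs) + inv (Hi xs) + cross xs)
        ≡⟨ cong (λ n → (n + lesser x (Hi xs)) + _)
                (lesser-all (Lo xs) (All.map (λ py → low<high py ¬px) (all-filter P? xs))) ⟩
      (length (Lo xs) + lesser x (Hi xs)) + (inv (Lo xs) + inv (Hi xs) + cross xs)
        ≡⟨ regroup (length (Lo xs)) (lesser x (Hi xs)) (inv (Lo xs)) (inv (Hi xs)) (cross xs) ⟩
      inv (Lo xs) + (lesser x (Hi xs) + inv (Hi xs)) + (length (Lo xs) + cross xs) ∎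
      where
      open ≡-Reasoning
      regroup : ∀ a b c d e → (a + b) + (c + d + e) ≡ c + (b + d) + (a + e)
      regroup = solve-∀

  cross≤ : ∀ xs → cross xs ≤ length (Hi xs) * length (Lo xs)
  cross≤ [] = z≤n
  cross≤ (x ∷ xs) with P? x
  ... | yes _ = ≤-trans (cross≤ xs) (*-monoʳ-≤ (length (Hi xs)) (n≤1+n _))
  ... | no _ = +-monoʳ-≤ (length (Lo xs)) (cross≤ xs)

  cross≥ : ∀ c xs → (∀ ys b zs → xs ≡ ys ++ b ∷ zs → ¬ P b → c ≤ length (Lo zs)) → length (Hi xs) * c ≤ cross xs
  cross≥ c [] _ = z≤n
  cross≥ c (x ∷ xs) after with P? x
  ... | yes _ = cross≥ c xs (λ ys b zs eq → after (x ∷ ys) b zs (cong (x ∷_) eq))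
  ... | no ¬px = +-mono-≤ (after [] x xs refl ¬px) (cross≥ c xs (λ ys b zs eq → after (x ∷ ys) b zs (cong (x ∷_) eq)))

Avoids132 : List ℕ → Set
Avoids132 π = ∀ {x y z} → (x ∷ y ∷ z ∷ []) ⊆ π → x < z → z < y → ⊥

Avoids132⇒Avoids1243 : ∀ {π} → Avoids132 π → Avoids1243 π
Avoids132⇒Avoids1243 av (_ , _ , _ , _ , p , _ , b<d , d<c) = av (∷ˡ⁻ p) b<d d<c

decreasing-++-Avoids132⇒Avoids1243 : ∀ {A B} → AllPairs (λ x y → y < x) A → Avoids132 B → Avoids1243 (A ++ B)
decreasing-++-Avoids132⇒Avoids1243 {A} {B} dec av (_ , _ , _ , _ , p , a<b , b<d , d<c) with ⊆-++⁻ A B p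
... | [] , _ , refl , _ , q = av (∷ˡ⁻ q) b<d d<c
... | _ ∷ [] , _ , refl , _ , q = av q b<d d<c
... | _ ∷ _ ∷ [] , _ , refl , q , _ = <-asym a<b (AllPairs-pair dec q)
... | _ ∷ _ ∷ _ ∷ [] , _ , refl , q , _ = <-asym a<b (AllPairs-pair dec q)
... | _ ∷ _ ∷ _ ∷ _ ∷ [] , _ , refl , q , _ = <-asym a<b (AllPairs-pair dec q)

layers : (ℕ → List ℕ) → ℕ → List ℕ
layers L zero = []
layers L (suc m) = L m ++ layers L m

module _ (L : ℕ → List ℕ) where

  ∈-layers⁺ : ∀ {x i m} → i < m → x ∈ L i → x ∈ layers L m
  ∈-layers⁺ {m = suc m} i<1+m x∈ with m<1+n⇒m<n∨m≡n i<1+m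
  ... | inj₁ i<m = ∈-++⁺ʳ (L m) (∈-layers⁺ i<m x∈)
  ... | inj₂ refl = ∈-++⁺ˡ x∈

  ∈-layers⁻ : ∀ {x} m → x ∈ layers L m → ∃ λ i → i < m × x ∈ L i
  ∈-layers⁻ (suc m) x∈ with ∈-++⁻ (L m) x∈
  ... | inj₁ p = m , n<1+n m , p
  ... | inj₂ p with i , i<m , q ← ∈-layers⁻ m p = i , m<n⇒m<1+n i<m , q

record Layered (L : ℕ → List ℕ) (c : ℕ) : Set where
  field
    length-layer : ∀ i → length (L i) ≡ c
    increasing   : ∀ i → AllPairs _<_ (L i)
    descending   : ∀ {i j x y} → j < i → x ∈ L i → y ∈ L j → y < x

module _ {L c} (lay : Layered L c) where
  open Layered lay

  above-layers : ∀ {m x y} → x ∈ L m → y ∈ layers L m → y < x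
  above-layers {m} x∈ y∈ with i , i<m , y∈′ ← ∈-layers⁻ L m y∈ = descending i<m x∈ y∈′

  layered-pair : ∀ {x y i j m} → i < m → x ∈ L i → y ∈ L j → j < i ⊎ (j ≡ i × x < y) → (x ∷ y ∷ []) ⊆ layers L m
  layered-pair {m = suc m} i<1+m x∈ y∈ order with m<1+n⇒m<n∨m≡n i<1+m | order
  ... | inj₁ i<m  | _                 = ⊆-++⁺ˡ (L m) (layered-pair i<m x∈ y∈ order)
  ... | inj₂ refl | inj₁ j<i          = ⊆-++⁺ (from∈ x∈) (from∈ (∈-layers⁺ L j<i y∈))
  ... | inj₂ refl | inj₂ (refl , x<y) = ⊆-++⁺ʳ (layers L m) (AllPairs⇒pair⊆ <-asym (increasing m) x∈ y∈ x<y)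

  length-layers : ∀ m → length (layers L m) ≡ m * c
  length-layers zero = refl
  length-layers (suc m) = trans (length-++ (L m)) (cong₂ _+_ (length-layer m) (length-layers m))

  inv-layers : ∀ m → inv (layers L m) ≡ c * c * (m C 2)
  inv-layers zero = sym (*-zeroʳ (c * c))
  inv-layers (suc m) = begin
    inv (L m ++ layers L m)
      ≡⟨ inv-++ (L m) (layers L m) ⟩
    inv (L m) + inv (layers L m) + invAcross (L m) (layers L m)
      ≡⟨ cong₂ (λ a b → a + inv (layers L m) + b) (inv-increasing (increasing m))
                (invAcross-all (L m) (layers L m) above-layers) ⟩
    inv (layers L m) + length (L m) * length (layers L m)
      ≡⟨ cong₂ _+_ (inv-layers m) (cong₂ _*_ (length-layer m) (length-layers m)) ⟩
    c * c * (m C 2) + c * (m * c)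
      ≡⟨ step c m (m C 2) ⟩
    c * c * (m + m C 2)
      ≡⟨ cong (c * c *_) (sym (C2-suc m)) ⟩
    c * c * (suc m C 2) ∎
    where
    open ≡-Reasoning
    step : ∀ c m k → c * c * k + c * (m * c) ≡ c * c * (m + k)
    step = solve-∀

  layers-Avoids132 : ∀ m → Avoids132 (layers L m)
  layers-Avoids132 (suc m) p x<z z<y with ⊆-++⁻ (L m) (layers L m) p
  ... | [] , _ , refl , _ , q = layers-Avoids132 m q x<z z<y
  ... | _ ∷ [] , _ , refl , q , r = <-asym x<z (above-layers (to∈ q) (to∈ (∷ˡ⁻ r)))
  ... | _ ∷ _ ∷ [] , _ , refl , q , r = <-asym x<z (above-layers (to∈ q) (to∈ r))
  ... | _ ∷ _ ∷ _ ∷ [] , _ , refl , q , _ = <-asym z<y (AllPairs-pair (increasing m) (∷ˡ⁻ q))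

-- Blocks and offsets are 0-based: cell i k = i·t + (k + 1) is the element (j − 1)t + r of
-- EN_{s,t} with j = i + 1 and r = k + 1.
module EN (u : ℕ) where

  t : ℕ
  t = suc u

  cell : ℕ → ℕ → ℕ
  cell i k = suc (i * t + k)

  head : ℕ → ℕ
  head i = cell i 0

  cell-<ʳ : ∀ {i k k'} → k < k' → cell i k < cell i k'
  cell-<ʳ {i} k<k' = s≤s (+-monoʳ-< (i * t) k<k')

  cell≤ : ∀ {i k} → k < t → cell i k ≤ suc i * t
  cell≤ {i} {k} k<t = begin
    suc (i * t + k) ≡⟨ sym (+-suc (i * t) k) ⟩
    i * t + suc k   ≤⟨ +-monoʳ-≤ (i * t) k<t ⟩
    i * t + t       ≡⟨ +-comm (i * t) t ⟩
    suc i * t       ∎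
    where open ≤-Reasoning

  *t<cell : ∀ i k → i * t < cell i k
  *t<cell i k = s≤s (m≤m+n (i * t) k)

  cell-high : ∀ m k → ¬ cell m k ≤ m * t
  cell-high m k = <⇒≱ (*t<cell m k)

  cell-≤ : ∀ {m i k} → i < m → k < t → cell i k ≤ m * t
  cell-≤ {i = i} i<m k<t = ≤-trans (cell≤ {i} k<t) (*-monoˡ-≤ t i<m)

  cell-<ˡ : ∀ {i j k k'} → j < i → k' < t → cell j k' < cell i k
  cell-<ˡ {i} {k = k} j<i k'<t = ≤-<-trans (cell-≤ j<i k'<t) (*t<cell i k)

  block blockTail : ℕ → List ℕ
  block i = applyUpTo (cell i) t
  blockTail i = applyUpTo (cell i ∘ suc) u

  block-high : ∀ {m x} → x ∈ block m → ¬ x ≤ m * t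
  block-high {m} x∈ with k , _ , refl ← ∈-applyUpTo⁻ (cell m) x∈ = cell-high m k

  block-Layered : Layered block t
  block-Layered = record
    { length-layer = λ i → length-applyUpTo (cell i) t
    ; increasing   = λ i → applyUpTo⁺₁ (cell i) t (λ k<k' _ → cell-<ʳ {i} k<k')
    ; descending   = descending
    }
    where
    descending : ∀ {i j x y} → j < i → x ∈ block i → y ∈ block j → y < x
    descending {i} {j} j<i x∈ y∈
      with _ , _ , refl ← ∈-applyUpTo⁻ (cell i) x∈ | _ , k'<t , refl ← ∈-applyUpTo⁻ (cell j) y∈ = cell-<ˡ j<i k'<t

  blockTail-Layered : Layered blockTail u
  blockTail-Layered = record
    { length-layer = λ i → length-applyUpTo (cell i ∘ suc) u
    ; increasing   = λ i → applyUpTo⁺₁ (cell i ∘ suc) u (λ k<k' _ → cell-<ʳ {i} (s≤s k<k'))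
    ; descending   = λ j<i x∈ y∈ → Layered.descending block-Layered j<i (there x∈) (there y∈)
    }

  applyUpTo-++ : ∀ (f : ℕ → ℕ) a b → applyUpTo f (a + b) ≡ applyUpTo f a ++ applyUpTo (f ∘ (a +_)) b
  applyUpTo-++ f zero b = refl
  applyUpTo-++ f (suc a) b = cong (f 0 ∷_) (applyUpTo-++ (f ∘ suc) a b)

  []≡applyUpTo : ∀ n → [ n ] ≡ applyUpTo suc n
  []≡applyUpTo = map-upTo suc

  []-suc : ∀ m → [ suc m * t ] ≡ [ m * t ] ++ block m
  []-suc m = begin
    [ t + m * t ]                                      ≡⟨ cong [_] (+-comm t (m * t)) ⟩
    [ m * t + t ]                                      ≡⟨ []≡applyUpTo (m * t + t) ⟩
    applyUpTo suc (m * t + t)                          ≡⟨ applyUpTo-++ suc (m * t) t ⟩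
    applyUpTo suc (m * t) ++ block m                   ≡⟨ cong (_++ block m) (sym ([]≡applyUpTo (m * t))) ⟩
    [ m * t ] ++ block m                               ∎
    where open ≡-Reasoning

  Unique-[] : ∀ n → Unique [ n ]
  Unique-[] n = subst Unique (sym ([]≡applyUpTo n)) (AllPairs.map <⇒≢ (applyUpTo⁺₁ suc n (λ i<j _ → s≤s i<j)))

  length-[] : ∀ n → length [ n ] ≡ n
  length-[] n = trans (cong length ([]≡applyUpTo n)) (length-applyUpTo suc n)

  ∈[]⇒≤ : ∀ {x n} → x ∈ [ n ] → x ≤ n
  ∈[]⇒≤ {x} {n} x∈ with _ , i<n , refl ← ∈-applyUpTo⁻ suc (subst (x ∈_) ([]≡applyUpTo n) x∈) = i<n

  πmax : ℕ → List ℕ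
  πmax = layers block

  πmax-↭ : ∀ m → πmax m ↭ [ m * t ]
  πmax-↭ zero = ↭-refl
  πmax-↭ (suc m) = begin
    block m ++ πmax m     ↭⟨ ++-comm (block m) (πmax m) ⟩
    πmax m ++ block m     ↭⟨ ↭-++⁺ʳ (block m) (πmax-↭ m) ⟩
    [ m * t ] ++ block m  ≡⟨ []-suc m ⟨
    [ suc m * t ]         ∎
    where open PermutationReasoning

  ∈[]⇒cell : ∀ {x} s → x ∈ [ s * t ] → ∃₂ λ i k → i < s × k < t × x ≡ cell i k
  ∈[]⇒cell s x∈ with i , i<s , x∈′ ← ∈-layers⁻ block s (∈-resp-↭ (↭-sym (πmax-↭ s)) x∈)
    with k , k<t , eq ← ∈-applyUpTo⁻ (cell i) x∈′ = i , k , i<s , k<t , eq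

  cell∈[] : ∀ {s i k} → i < s → k < t → cell i k ∈ [ s * t ]
  cell∈[] {s} {i} i<s k<t = ∈-resp-↭ (πmax-↭ s) (∈-layers⁺ block i<s (∈-applyUpTo⁺ (cell i) k<t))

  infix 4 _≼⟨_⟩_

  data _≼⟨_⟩_ : ℕ → ℕ → ℕ → Set where
    cells : ∀ {s i k i' k'} → i < s → i' < s → k < t → k' < t → i' ≤ i → k ≤ k' → cell i k ≼⟨ s ⟩ cell i' k'

  ENle⇒≼ : ∀ {s a b} → ENle s t a b → a ≼⟨ s ⟩ b
  ENle⇒≼ {s} (suc i , suc k , suc i' , suc k' , s≤s z≤n , i<s , s≤s z≤n , k<t , s≤s z≤n , i'<s , s≤s z≤n , k'<t ,
              refl , refl , s≤s i'≤i , s≤s k≤k') =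
    subst₂ (_≼⟨ s ⟩_) (sym (+-suc (i * t) k)) (sym (+-suc (i' * t) k')) (cells i<s i'<s k<t k'<t i'≤i k≤k')

  ≼⇒ENle : ∀ {s a b} → a ≼⟨ s ⟩ b → ENle s t a b
  ≼⇒ENle (cells {i = i} {k} {i'} {k'} i<s i'<s k<t k'<t i'≤i k≤k') =
    suc i , suc k , suc i' , suc k' , s≤s z≤n , i<s , s≤s z≤n , k<t , s≤s z≤n , i'<s , s≤s z≤n , k'<t ,
    sym (+-suc (i * t) k) , sym (+-suc (i' * t) k') , s≤s i'≤i , s≤s k≤k'

  ≼-cases : ∀ {i k i' k'} → i' ≤ i → k ≤ k' → cell i k ≢ cell i' k' → i' < i ⊎ (i' ≡ i × cell i k < cell i' k')
  ≼-cases {i} i'≤i k≤k' a≢b with m≤n⇒m<n∨m≡n i'≤i | m≤n⇒m<n∨m≡n k≤k'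
  ... | inj₁ i'<i | _ = inj₁ i'<i
  ... | inj₂ refl | inj₁ k<k' = inj₂ (refl , cell-<ʳ {i} k<k')
  ... | inj₂ refl | inj₂ refl = ⊥-elim (a≢b refl)

  pairs⇒IsLinExtEN : ∀ {s π} → π ↭ [ s * t ] →
                     (∀ {a b} → a ≼⟨ s ⟩ b → a ≢ b → (a ∷ b ∷ []) ⊆ π) → IsLinExtEN s t π
  pairs⇒IsLinExtEN perm pair = perm , λ a b a≼b a≢b → ⊆⇒Before (pair (ENle⇒≼ a≼b) a≢b)

  πmax-IsLinExt : ∀ m → IsLinExtEN m t (πmax m)
  πmax-IsLinExt m = pairs⇒IsLinExtEN (πmax-↭ m) pair
    where
    pair : ∀ {a b} → a ≼⟨ m ⟩ b → a ≢ b → (a ∷ b ∷ []) ⊆ πmax m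
    pair (cells {i = i} {k} {i'} {k'} i<m _ k<t k'<t i'≤i k≤k') a≢b =
      layered-pair block-Layered i<m (∈-applyUpTo⁺ (cell i) k<t) (∈-applyUpTo⁺ (cell i') k'<t) (≼-cases i'≤i k≤k' a≢b)

  heads : ℕ → List ℕ
  heads = applyDownFrom head

  heads-decreasing : ∀ m → AllPairs (λ x y → y < x) (heads m)
  heads-decreasing m = applyDownFrom⁺₁ head m (λ j<i _ → cell-<ˡ j<i (s≤s z≤n))

  length-heads : ∀ m → length (heads m) ≡ m
  length-heads zero = refl
  length-heads (suc m) = cong suc (length-heads m)

  rests : ℕ → List ℕ
  rests = layers blockTail

  πmin : ℕ → List ℕ
  πmin m = heads m ++ rests m

  πmin-↭ : ∀ m → πmin m ↭ πmax m
  πmin-↭ zero = ↭-refl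
  πmin-↭ (suc m) = ↭-prep (head m) (begin
    heads m ++ blockTail m ++ rests m  ↭⟨ shifts (heads m) (blockTail m) ⟩
    blockTail m ++ heads m ++ rests m  ↭⟨ ↭-++⁺ˡ (blockTail m) (πmin-↭ m) ⟩
    blockTail m ++ πmax m              ∎)
    where open PermutationReasoning

  πmin-IsLinExt : ∀ m → IsLinExtEN m t (πmin m)
  πmin-IsLinExt m = pairs⇒IsLinExtEN (↭-trans (πmin-↭ m) (πmax-↭ m)) pair
    where
    pair : ∀ {a b} → a ≼⟨ m ⟩ b → a ≢ b → (a ∷ b ∷ []) ⊆ πmin m
    pair (cells {i = i} {zero} {i'} {zero} i<m i'<m _ _ i'≤i _) a≢b with ≼-cases i'≤i z≤n a≢b
    ... | inj₁ i'<i = ⊆-++⁺ʳ (rests m) (AllPairs⇒pair⊆ (λ p q → <-asym p q) (heads-decreasing m)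
                        (∈-applyDownFrom⁺ head i<m) (∈-applyDownFrom⁺ head i'<m) (cell-<ˡ i'<i (s≤s z≤n)))
    ... | inj₂ (refl , a<a) = ⊥-elim (<-irrefl refl a<a)
    pair (cells {i = i} {zero} {i'} {suc k'} i<m i'<m _ k'<t _ _) _ =
      ⊆-++⁺ (from∈ (∈-applyDownFrom⁺ head i<m))
            (from∈ (∈-layers⁺ blockTail i'<m (∈-applyUpTo⁺ (cell i' ∘ suc) (≤-pred k'<t))))
    pair (cells {i = i} {suc k} {i'} {suc k'} i<m _ k<t k'<t i'≤i k≤k') a≢b =
      ⊆-++⁺ˡ (heads m) (layered-pair blockTail-Layered i<m (∈-applyUpTo⁺ (cell i ∘ suc) (≤-pred k<t))
                          (∈-applyUpTo⁺ (cell i' ∘ suc) (≤-pred k'<t)) (≼-cases i'≤i k≤k' a≢b))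

  πmax-Avoids1243 : ∀ m → Avoids1243 (πmax m)
  πmax-Avoids1243 m = Avoids132⇒Avoids1243 (layers-Avoids132 block-Layered m)

  πmin-Avoids1243 : ∀ m → Avoids1243 (πmin m)
  πmin-Avoids1243 m = decreasing-++-Avoids132⇒Avoids1243 (heads-decreasing m) (layers-Avoids132 blockTail-Layered m)

  inv-πmax : ∀ m → inv (πmax m) ≡ t * t * (m C 2)
  inv-πmax = inv-layers block-Layered

  invAcross-heads-rests : ∀ m → invAcross (heads m) (rests m) ≡ u * (m C 2)
  invAcross-heads-rests zero = sym (*-zeroʳ u)
  invAcross-heads-rests (suc m) = begin
    lesser (head m) (blockTail m ++ rests m) + invAcross (heads m) (blockTail m ++ rests m)
      ≡⟨ cong₂ _+_ (lesser-++ (head m) (blockTail m) (rests m)) (invAcross-++ (heads m) (blockTail m) (rests m)) ⟩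
    (lesser (head m) (blockTail m) + lesser (head m) (rests m)) + (invAcross (heads m) (blockTail m) + invAcross (heads m) (rests m))
      ≡⟨ cong₂ _+_ (cong₂ _+_ (lesser-none (blockTail m) (All.map <⇒≤ head<tail)) (lesser-all (rests m) (All.tabulate rests<head)))
                   (cong₂ _+_ (invAcross-none (heads m) (blockTail m) heads<tail) (invAcross-heads-rests m)) ⟩
    (0 + length (rests m)) + (0 + u * (m C 2))
      ≡⟨ cong (λ n → n + u * (m C 2)) (length-layers blockTail-Layered m) ⟩
    m * u + u * (m C 2)
      ≡⟨ step u m (m C 2) ⟩
    u * (m + m C 2)
      ≡⟨ cong (u *_) (C2-suc m) ⟨
    u * (suc m C 2) ∎
    where
    open ≡-Reasoning
    open Layered block-Layered
    head<tail : All (head m <_) (blockTail m)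
    head<tail with h< ∷ _ ← increasing m = h<
    rests<head : ∀ {y} → y ∈ rests m → y < head m
    rests<head y∈ with j , j<m , y∈′ ← ∈-layers⁻ blockTail m y∈ = descending j<m (here refl) (there y∈′)
    heads<tail : ∀ {x y} → x ∈ heads m → y ∈ blockTail m → x < y
    heads<tail x∈ y∈ with j , j<m , refl ← ∈-applyDownFrom⁻ head x∈ = descending j<m (there y∈) (here refl)
    step : ∀ u m c → m * u + u * c ≡ u * (m + c)
    step = solve-∀

  inv-πmin : ∀ m → inv (πmin m) ≡ (u * u + u + 1) * (m C 2)
  inv-πmin m = begin
    inv (heads m ++ rests m)
      ≡⟨ inv-++ (heads m) (rests m) ⟩
    inv (heads m) + inv (rests m) + invAcross (heads m) (rests m)
      ≡⟨ cong₂ _+_ (cong₂ _+_ (trans (inv-decreasing (heads-decreasing m)) (cong (_C 2) (length-heads m)))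
                              (inv-layers blockTail-Layered m))
                   (invAcross-heads-rests m) ⟩
    m C 2 + u * u * (m C 2) + u * (m C 2)
      ≡⟨ collect u (m C 2) ⟩
    (u * u + u + 1) * (m C 2) ∎
    where
    open ≡-Reasoning
    collect : ∀ u c → c + u * u * c + u * c ≡ (u * u + u + 1) * c
    collect = solve-∀

  module Extension {s π} (ext : IsLinExtEN s t π) where

    unique : Unique π
    unique = Unique-resp-↭ (setoid ℕ) (↭⇒↭ₛ (↭-sym (proj₁ ext))) (Unique-[] (s * t))

    ∈⇒cell : ∀ {x} → x ∈ π → ∃₂ λ i k → i < s × k < t × x ≡ cell i k
    ∈⇒cell x∈ = ∈[]⇒cell s (∈-resp-↭ (proj₁ ext) x∈)

    cell∈ : ∀ {i k} → i < s → k < t → cell i k ∈ π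
    cell∈ i<s k<t = ∈-resp-↭ (↭-sym (proj₁ ext)) (cell∈[] i<s k<t)

    ordered : ∀ {a b} → a ≼⟨ s ⟩ b → a ≢ b → (a ∷ b ∷ []) ⊆ π
    ordered a≼b a≢b = Before⇒⊆ (proj₂ ext _ _ (≼⇒ENle a≼b) a≢b)

  module TopBlock {m π} (ext : IsLinExtEN (suc m) t π) where
    open Extension ext public
    open Threshold (_≤? m * t) public

    low<high : ∀ {x y} → x ≤ m * t → ¬ y ≤ m * t → x < y
    low<high x≤ y≰ = ≤-<-trans x≤ (≰⇒> y≰)

    low-cell : ∀ {x} → x ∈ π → x ≤ m * t → ∃₂ λ i k → i < m × k < t × x ≡ cell i k
    low-cell x∈ x≤ with i , k , i<1+m , k<t , refl ← ∈⇒cell x∈ with m<1+n⇒m<n∨m≡n i<1+m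
    ... | inj₁ i<m = i , k , i<m , k<t , refl
    ... | inj₂ refl = ⊥-elim (cell-high m k x≤)

    high-cell : ∀ {x} → x ∈ π → ¬ x ≤ m * t → ∃ λ k → k < t × x ≡ cell m k
    high-cell x∈ x≰ with i , k , i<1+m , k<t , refl ← ∈⇒cell x∈ with m<1+n⇒m<n∨m≡n i<1+m
    ... | inj₁ i<m = ⊥-elim (x≰ (cell-≤ i<m k<t))
    ... | inj₂ refl = k , k<t , refl

    Lo-[] : Lo [ suc m * t ] ≡ [ m * t ]
    Lo-[] = begin
      Lo [ suc m * t ]
        ≡⟨ cong Lo ([]-suc m) ⟩
      Lo ([ m * t ] ++ block m)
        ≡⟨ filter-++ (_≤? m * t) [ m * t ] (block m) ⟩
      Lo [ m * t ] ++ Lo (block m)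
        ≡⟨ cong₂ _++_ (filter-all (_≤? m * t) (All.tabulate ∈[]⇒≤))
                      (filter-none (_≤? m * t) (All.tabulate (block-high {m}))) ⟩
      [ m * t ] ++ []
        ≡⟨ ++-identityʳ [ m * t ] ⟩
      [ m * t ] ∎
      where open ≡-Reasoning

    Hi-[] : Hi [ suc m * t ] ≡ block m
    Hi-[] = begin
      Hi [ suc m * t ]
        ≡⟨ cong Hi ([]-suc m) ⟩
      Hi ([ m * t ] ++ block m)
        ≡⟨ filter-++ (∁? (_≤? m * t)) [ m * t ] (block m) ⟩
      Hi [ m * t ] ++ Hi (block m)
        ≡⟨ cong₂ _++_ (filter-none (∁? (_≤? m * t)) (All.tabulate (λ x∈ x≰ → x≰ (∈[]⇒≤ x∈))))
                                                    (filter-all (∁? (_≤? m * t)) (All.tabulate (block-high {m}))) ⟩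
      block m                         ∎
      where open ≡-Reasoning

    length-Lo : length (Lo π) ≡ m * t
    length-Lo = trans (↭-length (filter-↭ (_≤? m * t) (proj₁ ext))) (trans (cong length Lo-[]) (length-[] (m * t)))

    length-Hi : length (Hi π) ≡ t
    length-Hi = trans (↭-length (filter-↭ (∁? (_≤? m * t)) (proj₁ ext)))
                      (trans (cong length Hi-[]) (length-applyUpTo (cell m) t))

    Lo-IsLinExt : IsLinExtEN m t (Lo π)
    Lo-IsLinExt = pairs⇒IsLinExtEN (↭-trans (filter-↭ (_≤? m * t) (proj₁ ext)) (↭-reflexive Lo-[])) pair
      where
      pair : ∀ {a b} → a ≼⟨ m ⟩ b → a ≢ b → (a ∷ b ∷ []) ⊆ Lo π
      pair (cells i<m i'<m k<t k'<t i'≤i k≤k') a≢b =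
        ⊆-filter (_≤? m * t) (ordered (cells (m<n⇒m<1+n i<m) (m<n⇒m<1+n i'<m) k<t k'<t i'≤i k≤k') a≢b)
                 (cell-≤ i<m k<t ∷ cell-≤ i'<m k'<t ∷ [])

    Lo-Avoids1243 : Avoids1243 π → Avoids1243 (Lo π)
    Lo-Avoids1243 av (a , b , c , d , p , ord) = av (a , b , c , d , ⊆-trans p (filter-⊆ (_≤? m * t) π) , ord)

    highs-increasing : ∀ {x y} → (x ∷ y ∷ []) ⊆ π → ¬ x ≤ m * t → ¬ y ≤ m * t → x < y
    highs-increasing p x≰ y≰ with high-cell (to∈ p) x≰ | high-cell (to∈ (∷ˡ⁻ p)) y≰
    ... | k , k<t , refl | k' , k'<t , refl with <-cmp k k'
    ...   | tri< k<k' _ _ = cell-<ʳ {m} k<k'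
    ...   | tri≈ _ refl _ = ⊥-elim (⊆-asym unique p p)
    ...   | tri> _ _ k'<k =
      ⊥-elim (⊆-asym unique p (ordered (cells ≤-refl ≤-refl k'<t k<t ≤-refl (<⇒≤ k'<k)) (<⇒≢ (cell-<ʳ {m} k'<k))))

    inv-Hi : inv (Hi π) ≡ 0
    inv-Hi = inv-increasing (pairs⇒AllPairs (Hi π) λ p → increasing p (All-resp-⊆ p (all-filter (∁? (_≤? m * t)) π)))
      where
      increasing : ∀ {x y} → (x ∷ y ∷ []) ⊆ Hi π → All (λ z → ¬ z ≤ m * t) (x ∷ y ∷ []) → x < y
      increasing p (x≰ ∷ y≰ ∷ []) = highs-increasing (⊆-trans p (filter-⊆ (∁? (_≤? m * t)) π)) x≰ y≰

    starts-with-head : Σ (List ℕ) λ rest → π ≡ head m ∷ rest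
    starts-with-head = go π refl
      where
      go : ∀ ρ → π ≡ ρ → Σ (List ℕ) λ rest → π ≡ head m ∷ rest
      go [] eq with () ← subst (head m ∈_) eq (cell∈ ≤-refl (s≤s z≤n))
      go (h ∷ rest) eq with h ≟ head m
      ... | yes refl = rest , eq
      ... | no h≢head with i , k , i<1+m , k<t , refl ← ∈⇒cell (subst (h ∈_) (sym eq) (here refl)) =
        ⊥-elim (nothing-before-head (subst Unique eq unique)
                 (subst ((head m ∷ h ∷ []) ⊆_) eq
                   (ordered (cells ≤-refl i<1+m (s≤s z≤n) k<t (m<1+n⇒m≤n i<1+m) z≤n) (h≢head ∘ sym))))

    low-before-high-is-head : Avoids1243 π → ∀ {i k kb} → i < m → k < t → kb < t →
                              (cell i k ∷ cell m kb ∷ []) ⊆ π → k ≡ 0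
    low-before-high-is-head av {k = zero} _ _ _ _ = refl
    low-before-high-is-head av {i} {suc k} {kb} i<m k<t kb<t y-before-b with m≤n⇒m<n∨m≡n (≤-pred k<t)
    ... | inj₂ refl = ⊥-elim (⊆-asym unique y-before-b
            (ordered (cells ≤-refl (m<n⇒m<1+n i<m) kb<t k<t (<⇒≤ i<m) (≤-pred kb<t)) (≢-sym (<⇒≢ (cell-<ˡ i<m k<t)))))
    ... | inj₁ k<u = ⊥-elim (av (head i , cell i (suc k) , cell m kb , cell i u ,
            ⊆-chain unique (ordered (cells i<1+m i<1+m (s≤s z≤n) k<t ≤-refl z≤n) (<⇒≢ head<y))
              (⊆-chain unique y-before-b (ordered (cells ≤-refl i<1+m kb<t ≤-refl (<⇒≤ i<m) (≤-pred kb<t)) (≢-sym (<⇒≢ top<b)))) ,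
            head<y , cell-<ʳ {i} k<u , top<b))
      where
      i<1+m = m<n⇒m<1+n i<m
      head<y = cell-<ʳ {i} (s≤s z≤n)
      top<b = cell-<ˡ i<m ≤-refl

    lows-before-high : Avoids1243 π → ∀ {xs b ys y} → π ≡ head m ∷ xs ++ b ∷ ys → ¬ b ≤ m * t →
                       y ∈ Lo xs → y ∈ heads m
    lows-before-high av {xs} {b} {ys} split b≰ y∈Lo
      with y∈xs , y≤ ← ∈-filter⁻ (_≤? m * t) {xs = xs} y∈Lo
      with i , k , i<m , k<t , refl ← low-cell (subst (_ ∈_) (sym split) (there (∈-++⁺ˡ {ys = b ∷ ys} y∈xs))) y≤
         | kb , kb<t , refl ← high-cell (subst (_ ∈_) (sym split) (there (∈-++⁺ʳ xs (here refl)))) b≰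
      with refl ← low-before-high-is-head av i<m k<t kb<t
                    (subst (_ ⊆_) (sym split) (head m ∷ʳ ⊆-++⁺ (from∈ y∈xs) (refl ∷ minimum ys)))
      = ∈-applyDownFrom⁺ head i<m

    lows-after-high : Avoids1243 π → ∀ {xs b ys} → π ≡ head m ∷ xs ++ b ∷ ys → ¬ b ≤ m * t → m * u ≤ length (Lo ys)
    lows-after-high av {xs} {b} {ys} split b≰ = +-cancelˡ-≤ m (m * u) (length (Lo ys)) (begin
      m + m * u                        ≡⟨ *-suc m u ⟨
      m * t                            ≡⟨ length-Lo ⟨
      length (Lo π)                    ≡⟨ cong length Lo-split ⟩
      length (Lo xs ++ Lo ys)          ≡⟨ length-++ (Lo xs) ⟩
      length (Lo xs) + length (Lo ys)  ≤⟨ +-monoˡ-≤ (length (Lo ys)) lows-before ⟩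
      m + length (Lo ys)               ∎)
      where
      open ≤-Reasoning
      Lo-split : Lo π ≡ Lo xs ++ Lo ys
      Lo-split = trans (cong Lo split) (trans (filter-reject (_≤? m * t) (cell-high m 0))
                   (trans (filter-++ (_≤? m * t) xs (b ∷ ys)) (cong (Lo xs ++_) (filter-reject (_≤? m * t) b≰))))
      Lo-xs⊆π : Lo xs ⊆ π
      Lo-xs⊆π = subst (_ ⊆_) (sym split) (head m ∷ʳ ⊆-trans (filter-⊆ (_≤? m * t) xs) (⊆-++⁺ʳ (b ∷ ys) ⊆-refl))
      lows-before : length (Lo xs) ≤ m
      lows-before = ≤-trans (Unique⇒length≤ (Lo xs) (heads m) (AllPairs-⊆ unique Lo-xs⊆π) (lows-before-high av split b≰))
                            (≤-reflexive (length-heads m))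

    cross-lower : Avoids1243 π → m * t + u * (m * u) ≤ cross π
    cross-lower av with rest , split ← starts-with-head = begin
      m * t + u * (m * u)                            ≡⟨ cong₂ (λ a b → a + b * (m * u)) length-Lo-rest length-Hi-rest ⟨
      length (Lo rest) + length (Hi rest) * (m * u)  ≤⟨ +-monoʳ-≤ (length (Lo rest)) (cross≥ (m * u) rest lows-after) ⟩
      length (Lo rest) + cross rest                  ≡⟨ cross-∷-high rest (cell-high m 0) ⟨
      cross (head m ∷ rest)                          ≡⟨ cong cross split ⟨
      cross π                                        ∎
      where
      open ≤-Reasoning
      length-Lo-rest : length (Lo rest) ≡ m * t
      length-Lo-rest = trans (cong length (sym (filter-reject (_≤? m * t) (cell-high m 0))))
                             (trans (cong (length ∘ Lo) (sym split)) length-Lo)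
      length-Hi-rest : length (Hi rest) ≡ u
      length-Hi-rest = suc-injective (trans (cong length (sym (filter-accept (∁? (_≤? m * t)) (cell-high m 0))))
                                            (trans (cong (length ∘ Hi) (sym split)) length-Hi))
      lows-after : ∀ xs b ys → rest ≡ xs ++ b ∷ ys → ¬ b ≤ m * t → m * u ≤ length (Lo ys)
      lows-after xs b ys eq = lows-after-high av (trans split (cong (head m ∷_) eq))

  inv-upper : ∀ s {π} → IsLinExtEN s t π → inv π ≤ t * t * (s C 2)
  inv-upper zero ext with refl ← ↭-empty-inv (proj₁ ext) = z≤n
  inv-upper (suc m) {π} ext = begin
    inv π
      ≡⟨ inv-split low<high π ⟩
    inv (Lo π) + inv (Hi π) + cross π
      ≤⟨ +-mono-≤ (+-monoˡ-≤ (inv (Hi π)) (inv-upper m Lo-IsLinExt)) (cross≤ π) ⟩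
    t * t * (m C 2) + inv (Hi π) + length (Hi π) * length (Lo π)
      ≡⟨ cong₂ (λ a b → t * t * (m C 2) + a + b) inv-Hi (cong₂ _*_ length-Hi length-Lo) ⟩
    t * t * (m C 2) + 0 + t * (m * t)
      ≡⟨ step t m (m C 2) ⟩
    t * t * (m + m C 2)
      ≡⟨ cong (t * t *_) (C2-suc m) ⟨
    t * t * (suc m C 2) ∎
    where
    open TopBlock ext
    open ≤-Reasoning
    step : ∀ t m c → t * t * c + 0 + t * (m * t) ≡ t * t * (m + c)
    step = solve-∀

  inv-lower : ∀ s {π} → IsLinExtEN s t π → Avoids1243 π → (u * u + u + 1) * (s C 2) ≤ inv π
  inv-lower zero _ _ = ≤-trans (≤-reflexive (*-zeroʳ (u * u + u + 1))) z≤n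
  inv-lower (suc m) {π} ext av = begin
    (u * u + u + 1) * (suc m C 2)
      ≡⟨ cong ((u * u + u + 1) *_) (C2-suc m) ⟩
    (u * u + u + 1) * (m + m C 2)
      ≡⟨ step u m (m C 2) ⟨
    (u * u + u + 1) * (m C 2) + 0 + (m * t + u * (m * u))
      ≤⟨ +-mono-≤ (+-monoˡ-≤ 0 (inv-lower m Lo-IsLinExt (Lo-Avoids1243 av))) (cross-lower av) ⟩
    inv (Lo π) + 0 + cross π
      ≡⟨ cong (λ a → inv (Lo π) + a + cross π) inv-Hi ⟨
    inv (Lo π) + inv (Hi π) + cross π
      ≡⟨ inv-split low<high π ⟨
    inv π ∎
    where
    open TopBlock ext
    open ≤-Reasoning
    step : ∀ u m c → (u * u + u + 1) * c + 0 + (m * suc u + u * (m * u)) ≡ (u * u + u + 1) * (m + c)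
    step = solve-∀

^2≡* : ∀ n → n ^ 2 ≡ n * n
^2≡* n = cong (n *_) (*-identityʳ n)

suc^2∸suc+1 : ∀ u → suc u ^ 2 ∸ suc u + 1 ≡ u * u + u + 1
suc^2∸suc+1 u = cong (_+ 1) (trans (cong (_∸ suc u) (^2≡* (suc u)))
                  (trans (m+n∸m≡n (suc u) (u * suc u)) (trans (*-suc u u) (+-comm u (u * u)))))

theorem6p3 : (s t : ℕ) → 1 ≤ s → 1 ≤ t →
    ((Σ (List ℕ) λ π → IsLinExtEN s t π × Avoids1243 π × (inv π ≡ (t ^ 2 ∸ t + 1) * (s C 2)))
      × (∀ π → IsLinExtEN s t π → Avoids1243 π → (t ^ 2 ∸ t + 1) * (s C 2) ≤ inv π))
    ×
    ((Σ (List ℕ) λ π → IsLinExtEN s t π × Avoids1243 π × (inv π ≡ t ^ 2 * (s C 2)))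
      × (∀ π → IsLinExtEN s t π → Avoids1243 π → inv π ≤ t ^ 2 * (s C 2)))
theorem6p3 s (suc u) _ (s≤s z≤n) =
  ((πmin s , πmin-IsLinExt s , πmin-Avoids1243 s , trans (inv-πmin s) (sym min-coeff)) ,
   λ π ext av → subst (_≤ inv π) (sym min-coeff) (inv-lower s ext av)) ,
  ((πmax s , πmax-IsLinExt s , πmax-Avoids1243 s , trans (inv-πmax s) (sym max-coeff)) ,
   λ π ext _ → subst (inv π ≤_) (sym max-coeff) (inv-upper s ext))
  where
  open EN u
  min-coeff : (t ^ 2 ∸ t + 1) * (s C 2) ≡ (u * u + u + 1) * (s C 2)
  min-coeff = cong (_* (s C 2)) (suc^2∸suc+1 u)
  max-coeff : t ^ 2 * (s C 2) ≡ t * t * (s C 2)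
  max-coeff = cong (_* (s C 2)) (^2≡* t)
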